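{- Let $\lambda$ be a nonzero real number and let $(b_n(\lambda))_{n\ge0}$ be any sequence of real numbers. Define the degenerate A-algorithm matrix $(b_{n,m}(\lambda))_{n,m\ge0}$ by $b_{0,m}(\lambda)=b_m(\lambda)$ for $m\ge0$ and \[ b_{n,m}(\lambda)=(m+1)\Big(\Big(1-\frac{(n-1)\lambda}{m+1}\Big)b_{n-1,m}(\lambda)-b_{n-1,m+1}(\lambda)\Big),\qquad n\ge1,\ m\ge0. \] Then for every $n\ge0$, \[ b_{n,0}(\lambda)=\sum_{k=0}^{n}(-1)^{k}k!\Big({n+1 \brace k+1}_{\lambda}+n\lambda {n \brace k+1}_{\lambda}\Big)b_{0,k}(\lambda). \]
   Context: For $n\ge0$ set $(x)_{0,\lambda}=1$, $(x)_{n,\lambda}=x(x-\lambda)\cdots(x-(n-1)\lambda)$ for $n\ge1$, and $(x)_0=1$, $(x)_n=x(x-1)\cdots(x-n+1)$ for $n\ge1$. The degenerate Stirling numbers of the second kind ${n \brace k}_{\lambda}$ are defined by $(x)_{n,\lambda}=\sum_{k=0}^{n}{n \brace k}_{\lambda}(x)_{k}$ for $n\ge0$, with ${n \brace k}_\lambda=0$ for $k>n$. -}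

module Defs where

open import Level using (_⊔_)
open import Algebra.Bundles using (CommutativeRing)
open import Data.Nat using (ℕ; zero; suc; _<_)
open import Data.Product using (_×_)
open import Relation.Nullary using (¬_)

module _ {c ℓ} (R : CommutativeRing c ℓ) where
  open CommutativeRing R

  fromℕ : ℕ → Carrier
  fromℕ zero    = 0#
  fromℕ (suc n) = 1# + fromℕ n

  sgn : ℕ → Carrier
  sgn zero    = 1#
  sgn (suc k) = - (sgn k)

  fact : ℕ → Carrier
  fact zero    = 1#
  fact (suc k) = fromℕ (suc k) * fact k

  sumTo : ℕ → (ℕ → Carrier) → Carrier
  sumTo zero    f = f 0
  sumTo (suc n) f = sumTo n f + f (suc n)

  fall : Carrier → ℕ → Carrier
  fall x zero    = 1#
  fall x (suc n) = fall x n * (x - fromℕ n)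

  fallD : Carrier → Carrier → ℕ → Carrier
  fallD lam x zero    = 1#
  fallD lam x (suc n) = fallD lam x n * (x - fromℕ n * lam)

  IsDegStirling2 : Carrier → (ℕ → ℕ → Carrier) → Set (c ⊔ ℓ)
  IsDegStirling2 lam S =
    (∀ n k → n < k → S n k ≈ 0#) ×
    (∀ n x → fallD lam x n ≈ sumTo n (λ k → S n k * fall x k))

  -- the additive group of R is torsion-free (holds e.g. for ℝ)
  TorsionFree : Set (c ⊔ ℓ)
  TorsionFree = ∀ m a → fromℕ (suc m) * a ≈ 0# → a ≈ 0#

  -- degenerate A-algorithm matrix: b_{0,m} = b_m and for n ≥ 1
  -- b_{n,m} = (m+1) ((1 - (n-1)λ/(m+1)) b_{n-1,m} - b_{n-1,m+1})
  --         = ((m+1) - (n-1)λ) b_{n-1,m} - (m+1) b_{n-1,m+1}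
  bmat : Carrier → (ℕ → Carrier) → ℕ → ℕ → Carrier
  bmat lam b zero    m = b m
  bmat lam b (suc n) m =
    (fromℕ (suc m) - fromℕ n * lam) * bmat lam b n m
      - fromℕ (suc m) * bmat lam b n (suc m)

{-# OPTIONS --safe #-}

-- Row n + 1 of the matrix is step (n λ) applied to row n, where
-- step d f m = (m + 1 - d) f m - (m + 1) f (m + 1). These operators commute and satisfy
-- step d f = step e f + (e - d) f, so the recurrence S(n+1,k) = S(n,k-1) + (k - nλ) S(n,k)
-- gives, by induction, b_{n,m} = Σ_k S(n,k) a_{k,m}, where a is the matrix for λ = 1. The
-- recurrence is forced by the defining identity because falling factorials are linearly
-- independent over a torsion-free ring. Commutativity also gives
-- a_{k,0} = (-1)^k k! (b_k - b_{k-1}), and summation by parts turns Σ_k S(n,k) a_{k,0} into the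
-- stated sum: its coefficient S(n,k) + (k+1) S(n,k+1) is S(n+1,k+1) + nλ S(n,k+1) by the
-- recurrence.

module Submission where

open import Defs
open import Level using (Level)
open import Algebra.Bundles using (CommutativeRing)
open import Algebra.Solver.Ring.AlmostCommutativeRing
  using (fromCommutativeRing; _-Raw-AlmostCommutative⟶_)
open import Data.Nat as ℕ using (ℕ; zero; suc; _≤_; _<_; z≤n; s≤s)
import Data.Nat.Properties as ℕ
open import Data.Integer as ℤ using (ℤ; +_; -[1+_]; _⊖_; _◃_)
import Data.Integer.Properties as ℤ
open import Data.Sign as Sign using ()
open import Data.Maybe using (Maybe; just; nothing)
open import Data.Product using (proj₁; proj₂)
import Relation.Binary.PropositionalEquality as ≡
open import Relation.Nullary using (¬_; yes; no)
import Relation.Binary.Reasoning.Setoid as SetoidReasoning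

-- Algebra.Solver.Ring only cancels coefficients whose equality it can decide, so ℤ, which
-- maps into every ring, serves as the coefficient ring.
module IntegerCoefficientSolver {c ℓ} (R : CommutativeRing c ℓ) where
  open CommutativeRing R
  open import Algebra.Properties.Ring ring
    using (-0#≈0#; -‿involutive; -‿distribˡ-*; -‿distribʳ-*; -‿+-comm; xyx⁻¹≈y)
  open import Algebra.Properties.Semiring.Mult.TCOptimised semiring
    using (_×_; 1+×; ×-homo-+; ×1-homo-*)
  open SetoidReasoning setoid

  fromℤ : ℤ → Carrier
  fromℤ (+ n)    = n × 1#
  fromℤ -[1+ n ] = - (suc n × 1#)

  +-cancelˡ-- : ∀ x a b → (x + a) - (x + b) ≈ a - b
  +-cancelˡ-- x a b = begin
    (x + a) + - (x + b)     ≈⟨ +-congˡ (-‿+-comm x b) ⟨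
    (x + a) + (- x + - b)   ≈⟨ +-assoc (x + a) (- x) (- b) ⟨
    ((x + a) + - x) + - b   ≈⟨ +-congʳ (xyx⁻¹≈y x a) ⟩
    a + - b                 ∎

  fromℤ-⊖ : ∀ m n → fromℤ (m ⊖ n) ≈ m × 1# - n × 1#
  fromℤ-⊖ zero    zero    = sym (-‿inverseʳ 0#)
  fromℤ-⊖ zero    (suc n) = sym (+-identityˡ _)
  fromℤ-⊖ (suc m) zero    = sym (trans (+-congˡ -0#≈0#) (+-identityʳ _))
  fromℤ-⊖ (suc m) (suc n) = begin
    fromℤ (suc m ⊖ suc n)          ≡⟨ ≡.cong fromℤ (ℤ.[1+m]⊖[1+n]≡m⊖n m n) ⟩
    fromℤ (m ⊖ n)                  ≈⟨ fromℤ-⊖ m n ⟩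
    m × 1# - n × 1#                ≈⟨ +-cancelˡ-- 1# (m × 1#) (n × 1#) ⟨
    (1# + m × 1#) - (1# + n × 1#)  ≈⟨ +-cong (1+× m 1#) (-‿cong (1+× n 1#)) ⟨
    suc m × 1# - suc n × 1#        ∎

  fromℤ-+ : ∀ i j → fromℤ (i ℤ.+ j) ≈ fromℤ i + fromℤ j
  fromℤ-+ (+ m)    (+ n)    = ×-homo-+ 1# m n
  fromℤ-+ (+ m)    -[1+ n ] = fromℤ-⊖ m (suc n)
  fromℤ-+ -[1+ m ] (+ n)    = trans (fromℤ-⊖ n (suc m)) (+-comm _ _)
  fromℤ-+ -[1+ m ] -[1+ n ] = begin
    - (suc (suc (m ℕ.+ n)) × 1#)     ≡⟨ ≡.cong (λ k → - (suc k × 1#)) (ℕ.+-suc m n) ⟨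
    - ((suc m ℕ.+ suc n) × 1#)       ≈⟨ -‿cong (×-homo-+ 1# (suc m) (suc n)) ⟩
    - (suc m × 1# + suc n × 1#)      ≈⟨ -‿+-comm _ _ ⟨
    - (suc m × 1#) + - (suc n × 1#)  ∎

  fromℤ-neg : ∀ i → fromℤ (ℤ.- i) ≈ - fromℤ i
  fromℤ-neg (+ zero)  = sym -0#≈0#
  fromℤ-neg (+ suc n) = refl
  fromℤ-neg -[1+ n ]  = sym (-‿involutive _)

  fromℤ-+◃ : ∀ n → fromℤ (Sign.+ ◃ n) ≈ n × 1#
  fromℤ-+◃ zero    = refl
  fromℤ-+◃ (suc n) = refl

  fromℤ--◃ : ∀ n → fromℤ (Sign.- ◃ n) ≈ - (n × 1#)
  fromℤ--◃ zero    = sym -0#≈0#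
  fromℤ--◃ (suc n) = refl

  fromℤ-* : ∀ i j → fromℤ (i ℤ.* j) ≈ fromℤ i * fromℤ j
  fromℤ-* (+ m) (+ n) = trans (fromℤ-+◃ (m ℕ.* n)) (×1-homo-* m n)
  fromℤ-* (+ m) -[1+ n ] = begin
    fromℤ (Sign.- ◃ m ℕ.* suc n)  ≈⟨ fromℤ--◃ (m ℕ.* suc n) ⟩
    - ((m ℕ.* suc n) × 1#)        ≈⟨ -‿cong (×1-homo-* m (suc n)) ⟩
    - (m × 1# * suc n × 1#)       ≈⟨ -‿distribʳ-* _ _ ⟩
    m × 1# * - (suc n × 1#)       ∎
  fromℤ-* -[1+ m ] (+ n) = begin
    fromℤ (Sign.- ◃ suc m ℕ.* n)  ≈⟨ fromℤ--◃ (suc m ℕ.* n) ⟩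
    - ((suc m ℕ.* n) × 1#)        ≈⟨ -‿cong (×1-homo-* (suc m) n) ⟩
    - (suc m × 1# * n × 1#)       ≈⟨ -‿distribˡ-* _ _ ⟩
    - (suc m × 1#) * n × 1#       ∎
  fromℤ-* -[1+ m ] -[1+ n ] = begin
    (suc m ℕ.* suc n) × 1#            ≈⟨ ×1-homo-* (suc m) (suc n) ⟩
    suc m × 1# * suc n × 1#           ≈⟨ -‿involutive _ ⟨
    - - (suc m × 1# * suc n × 1#)     ≈⟨ -‿cong (-‿distribˡ-* _ _) ⟩
    - (- (suc m × 1#) * suc n × 1#)   ≈⟨ -‿distribʳ-* _ _ ⟩
    - (suc m × 1#) * - (suc n × 1#)   ∎

  fromℤ-homomorphism : ℤ.+-*-rawRing -Raw-AlmostCommutative⟶ fromCommutativeRing R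
  fromℤ-homomorphism = record
    { ⟦_⟧    = fromℤ
    ; +-homo = fromℤ-+
    ; *-homo = fromℤ-*
    ; -‿homo = fromℤ-neg
    ; 0-homo = refl
    ; 1-homo = refl
    }

  fromℤ-≟ : ∀ i j → Maybe (fromℤ i ≈ fromℤ j)
  fromℤ-≟ i j with i ℤ.≟ j
  ... | yes ≡.refl = just refl
  ... | no  _      = nothing

  open import Algebra.Solver.Ring
    ℤ.+-*-rawRing (fromCommutativeRing R) fromℤ-homomorphism fromℤ-≟ public

module SumProperties {c ℓ} (R : CommutativeRing c ℓ) where
  open CommutativeRing R
  open import Algebra.Properties.Ring ring using (-‿+-comm; x[y-z]≈xy-xz; [y-z]x≈yx-zx)
  open import Algebra.Properties.CommutativeSemigroup +-commutativeSemigroup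
    using () renaming (interchange to +-interchange)
  open import Algebra.Properties.CommutativeSemigroup *-commutativeSemigroup using (xy∙z≈y∙xz)
  open SetoidReasoning setoid

  ∑ : ℕ → (ℕ → Carrier) → Carrier
  ∑ = sumTo R

  shift : (ℕ → Carrier) → ℕ → Carrier
  shift a zero    = 0#
  shift a (suc k) = a k

  Δ : (ℕ → Carrier) → ℕ → Carrier
  Δ a k = a k - shift a k

  ∑-cong : ∀ n {f g : ℕ → Carrier} → (∀ k → f k ≈ g k) → ∑ n f ≈ ∑ n g
  ∑-cong zero    f≈g = f≈g 0
  ∑-cong (suc n) f≈g = +-cong (∑-cong n f≈g) (f≈g (suc n))

  ∑-0 : ∀ n {f : ℕ → Carrier} → (∀ k → f k ≈ 0#) → ∑ n f ≈ 0#
  ∑-0 zero    f≈0 = f≈0 0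
  ∑-0 (suc n) f≈0 = trans (+-cong (∑-0 n f≈0) (f≈0 (suc n))) (+-identityʳ 0#)

  ∑-+ : ∀ n (f g : ℕ → Carrier) → ∑ n (λ k → f k + g k) ≈ ∑ n f + ∑ n g
  ∑-+ zero    f g = refl
  ∑-+ (suc n) f g = trans (+-congʳ (∑-+ n f g)) (+-interchange _ _ _ _)

  ∑-neg : ∀ n (f : ℕ → Carrier) → ∑ n (λ k → - f k) ≈ - ∑ n f
  ∑-neg zero    f = refl
  ∑-neg (suc n) f = trans (+-congʳ (∑-neg n f)) (-‿+-comm _ _)

  ∑-- : ∀ n (f g : ℕ → Carrier) → ∑ n (λ k → f k - g k) ≈ ∑ n f - ∑ n g
  ∑-- n f g = trans (∑-+ n f (λ k → - g k)) (+-congˡ (∑-neg n g))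

  ∑-*ˡ : ∀ n a (f : ℕ → Carrier) → a * ∑ n f ≈ ∑ n (λ k → a * f k)
  ∑-*ˡ zero    a f = refl
  ∑-*ˡ (suc n) a f = trans (distribˡ a _ _) (+-congʳ (∑-*ˡ n a f))

  ∑-*ʳ : ∀ n a (f : ℕ → Carrier) → ∑ n f * a ≈ ∑ n (λ k → f k * a)
  ∑-*ʳ zero    a f = refl
  ∑-*ʳ (suc n) a f = trans (distribʳ a _ _) (+-congʳ (∑-*ʳ n a f))

  ∑-suc : ∀ n (f : ℕ → Carrier) → ∑ (suc n) f ≈ f 0 + ∑ n (λ k → f (suc k))
  ∑-suc zero    f = refl
  ∑-suc (suc n) f = trans (+-congʳ (∑-suc n f)) (+-assoc _ _ _)

  ∑-last≈0 : ∀ n (f : ℕ → Carrier) → f (suc n) ≈ 0# → ∑ (suc n) f ≈ ∑ n f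
  ∑-last≈0 n f fₙ₊₁≈0 = trans (+-congˡ fₙ₊₁≈0) (+-identityʳ _)

  ∑-shift : ∀ n (a f : ℕ → Carrier) →
    ∑ (suc n) (λ k → shift a k * f k) ≈ ∑ n (λ k → a k * f (suc k))
  ∑-shift n a f = trans (∑-suc n _) (trans (+-congʳ (zeroˡ (f 0))) (+-identityˡ _))

  ∑-shift-adjoint : ∀ n (a e f : ℕ → Carrier) → a (suc n) ≈ 0# →
    ∑ (suc n) (λ k → (shift a k + e k * a k) * f k) ≈ ∑ n (λ k → a k * (f (suc k) + e k * f k))
  ∑-shift-adjoint n a e f aₙ₊₁≈0 = begin
    ∑ (suc n) (λ k → (shift a k + e k * a k) * f k)
      ≈⟨ ∑-cong (suc n) (λ k → distribʳ (f k) _ _) ⟩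
    ∑ (suc n) (λ k → shift a k * f k + e k * a k * f k)
      ≈⟨ ∑-+ (suc n) _ _ ⟩
    ∑ (suc n) (λ k → shift a k * f k) + ∑ (suc n) (λ k → e k * a k * f k)
      ≈⟨ +-cong (∑-shift n a f) (∑-last≈0 n _ last≈0) ⟩
    ∑ n (λ k → a k * f (suc k)) + ∑ n (λ k → e k * a k * f k)
      ≈⟨ ∑-+ n _ _ ⟨
    ∑ n (λ k → a k * f (suc k) + e k * a k * f k)
      ≈⟨ ∑-cong n (λ k → trans (+-congˡ (xy∙z≈y∙xz _ _ _)) (sym (distribˡ (a k) _ _))) ⟩
    ∑ n (λ k → a k * (f (suc k) + e k * f k)) ∎
    where
    last≈0 : e (suc n) * a (suc n) * f (suc n) ≈ 0#
    last≈0 = trans (*-congʳ (trans (*-congˡ aₙ₊₁≈0) (zeroʳ _))) (zeroˡ _)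

  ∑-by-parts : ∀ n (a b : ℕ → Carrier) → a (suc n) ≈ 0# →
    ∑ n (λ k → a k * Δ b k) ≈ ∑ n (λ k → (a k - a (suc k)) * b k)
  ∑-by-parts n a b aₙ₊₁≈0 = begin
    ∑ n (λ k → a k * Δ b k)
      ≈⟨ ∑-cong n (λ k → x[y-z]≈xy-xz (a k) _ _) ⟩
    ∑ n (λ k → a k * b k - a k * shift b k)
      ≈⟨ ∑-- n _ _ ⟩
    ∑ n (λ k → a k * b k) - ∑ n (λ k → a k * shift b k)
      ≈⟨ +-congˡ (-‿cong shifted) ⟩
    ∑ n (λ k → a k * b k) - ∑ n (λ k → b k * a (suc k))
      ≈⟨ ∑-- n _ _ ⟨
    ∑ n (λ k → a k * b k - b k * a (suc k))
      ≈⟨ ∑-cong n regroup ⟩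
    ∑ n (λ k → (a k - a (suc k)) * b k) ∎
    where
    shifted : ∑ n (λ k → a k * shift b k) ≈ ∑ n (λ k → b k * a (suc k))
    shifted = begin
      ∑ n (λ k → a k * shift b k)        ≈⟨ ∑-last≈0 n _ (trans (*-congʳ aₙ₊₁≈0) (zeroˡ _)) ⟨
      ∑ (suc n) (λ k → a k * shift b k)  ≈⟨ ∑-cong (suc n) (λ k → *-comm (a k) _) ⟩
      ∑ (suc n) (λ k → shift b k * a k)  ≈⟨ ∑-shift n b a ⟩
      ∑ n (λ k → b k * a (suc k))        ∎
    regroup : ∀ k → a k * b k - b k * a (suc k) ≈ (a k - a (suc k)) * b k
    regroup k = trans (+-congˡ (-‿cong (*-comm (b k) _))) (sym ([y-z]x≈yx-zx (b k) _ _))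

module FallingFactorialProperties {c ℓ} (R : CommutativeRing c ℓ) where
  open CommutativeRing R
  open import Algebra.Properties.CommutativeSemigroup *-commutativeSemigroup using (x∙yz≈y∙xz)
  open SetoidReasoning setoid
  open IntegerCoefficientSolver R
  open SumProperties R

  fall-suc-diag : ∀ x a k →
    fall R x (suc k) + (fromℕ R k - a) * fall R x k ≈ fall R x k * (x - a)
  fall-suc-diag x a k = solve 4 (λ F x K a → F :* (x :- K) :+ (K :- a) :* F := F :* (x :- a))
    refl (fall R x k) x (fromℕ R k) a

  fall-1+ : ∀ y k → fall R (1# + y) (suc k) ≈ (1# + y) * fall R y k
  fall-1+ y zero    = solve 1
    (λ y → con (+ 1) :* ((con (+ 1) :+ y) :- con (+ 0)) := (con (+ 1) :+ y) :* con (+ 1)) refl y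
  fall-1+ y (suc k) = trans (*-congʳ (fall-1+ y k))
    (solve 3 (λ y F K → (con (+ 1) :+ y) :* F :* ((con (+ 1) :+ y) :- (con (+ 1) :+ K))
                        := (con (+ 1) :+ y) :* (F :* (y :- K)))
       refl y (fall R y k) (fromℕ R k))

  fall-0 : ∀ k → fall R 0# (suc k) ≈ 0#
  fall-0 zero    = trans (*-identityˡ _) (-‿inverseʳ 0#)
  fall-0 (suc k) = trans (*-congʳ (fall-0 k)) (zeroˡ _)

  ∑-fall-0 : ∀ n (d : ℕ → Carrier) → ∑ n (λ k → d k * fall R 0# k) ≈ d 0
  ∑-fall-0 zero    d = *-identityʳ (d 0)
  ∑-fall-0 (suc n) d = begin
    ∑ (suc n) (λ k → d k * fall R 0# k)
      ≈⟨ ∑-suc n _ ⟩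
    d 0 * 1# + ∑ n (λ k → d (suc k) * fall R 0# (suc k))
      ≈⟨ +-cong (*-identityʳ (d 0)) (∑-0 n vanish) ⟩
    d 0 + 0#
      ≈⟨ +-identityʳ (d 0) ⟩
    d 0 ∎
    where
    vanish : ∀ k → d (suc k) * fall R 0# (suc k) ≈ 0#
    vanish k = trans (*-congˡ (fall-0 k)) (zeroʳ _)

  ∑-fall-1+ : ∀ n (d : ℕ → Carrier) y →
    ∑ (suc n) (λ k → d k * fall R (1# + y) k)
      ≈ d 0 * 1# + (1# + y) * ∑ n (λ k → d (suc k) * fall R y k)
  ∑-fall-1+ n d y = trans (∑-suc n _) (+-congˡ (begin
    ∑ n (λ k → d (suc k) * fall R (1# + y) (suc k))
      ≈⟨ ∑-cong n (λ k → *-congˡ (fall-1+ y k)) ⟩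
    ∑ n (λ k → d (suc k) * ((1# + y) * fall R y k))
      ≈⟨ ∑-cong n (λ k → x∙yz≈y∙xz (d (suc k)) _ _) ⟩
    ∑ n (λ k → (1# + y) * (d (suc k) * fall R y k))
      ≈⟨ ∑-*ˡ n _ _ ⟨
    (1# + y) * ∑ n (λ k → d (suc k) * fall R y k) ∎))

  -- Evaluating at 0 isolates d 0; evaluating at m + 1 and cancelling the factor m + 1
  -- leaves the same situation for the coefficients d (suc k) at the points m.
  fall-independent : TorsionFree R → ∀ n (d : ℕ → Carrier) →
    (∀ m → ∑ n (λ k → d k * fall R (fromℕ R m) k) ≈ 0#) → ∀ k → k ≤ n → d k ≈ 0#
  fall-independent tf n d vanish zero _ = trans (sym (∑-fall-0 n d)) (vanish 0)
  fall-independent tf (suc n) d vanish (suc k) (s≤s k≤n) =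
    fall-independent tf n (λ k → d (suc k)) vanish′ k k≤n
    where
    d₀≈0 : d 0 ≈ 0#
    d₀≈0 = fall-independent tf (suc n) d vanish 0 z≤n
    vanish′ : ∀ m → ∑ n (λ k → d (suc k) * fall R (fromℕ R m) k) ≈ 0#
    vanish′ m = tf m _ (begin
      fromℕ R (suc m) * ∑ n (λ k → d (suc k) * fall R (fromℕ R m) k)
        ≈⟨ +-identityˡ _ ⟨
      0# + fromℕ R (suc m) * ∑ n (λ k → d (suc k) * fall R (fromℕ R m) k)
        ≈⟨ +-congʳ (trans (*-congʳ d₀≈0) (zeroˡ 1#)) ⟨
      d 0 * 1# + fromℕ R (suc m) * ∑ n (λ k → d (suc k) * fall R (fromℕ R m) k)
        ≈⟨ ∑-fall-1+ n d (fromℕ R m) ⟨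
      ∑ (suc n) (λ k → d k * fall R (fromℕ R (suc m)) k)
        ≈⟨ vanish (suc m) ⟩
      0# ∎)

module DegenerateStirlingRecurrence
  {c ℓ} (R : CommutativeRing c ℓ) (tf : TorsionFree R)
  (lam : CommutativeRing.Carrier R) (S : ℕ → ℕ → CommutativeRing.Carrier R)
  (isS : IsDegStirling2 R lam S) where
  open CommutativeRing R
  open import Algebra.Properties.Ring ring using (x∙y⁻¹≈ε⇒x≈y; [y-z]x≈yx-zx)
  open SetoidReasoning setoid
  open SumProperties R
  open FallingFactorialProperties R

  diag : ℕ → ℕ → Carrier
  diag n k = fromℕ R k - fromℕ R n * lam

  S-vanish : ∀ n k → n < k → S n k ≈ 0#
  S-vanish = proj₁ isS

  S-expansion : ∀ n x → fallD R lam x n ≈ ∑ n (λ k → S n k * fall R x k)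
  S-expansion = proj₂ isS

  S₀₀≈1 : S 0 0 ≈ 1#
  S₀₀≈1 = trans (sym (*-identityʳ (S 0 0))) (sym (S-expansion 0 0#))

  next-row-expansion : ∀ n x →
    ∑ (suc n) (λ k → (shift (S n) k + diag n k * S n k) * fall R x k) ≈ fallD R lam x (suc n)
  next-row-expansion n x = begin
    ∑ (suc n) (λ k → (shift (S n) k + diag n k * S n k) * fall R x k)
      ≈⟨ ∑-shift-adjoint n (S n) (diag n) (fall R x) (S-vanish n (suc n) (ℕ.n<1+n n)) ⟩
    ∑ n (λ k → S n k * (fall R x (suc k) + diag n k * fall R x k))
      ≈⟨ ∑-cong n (λ k → trans (*-congˡ (fall-suc-diag x _ k)) (sym (*-assoc _ _ _))) ⟩
    ∑ n (λ k → S n k * fall R x k * (x - fromℕ R n * lam))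
      ≈⟨ ∑-*ʳ n _ _ ⟨
    ∑ n (λ k → S n k * fall R x k) * (x - fromℕ R n * lam)
      ≈⟨ *-congʳ (S-expansion n x) ⟨
    fallD R lam x (suc n) ∎

  S-recurrence : ∀ n k → S (suc n) k ≈ shift (S n) k + diag n k * S n k
  S-recurrence n k with k ℕ.≤? suc n
  ... | yes k≤1+n = x∙y⁻¹≈ε⇒x≈y _ _
    (fall-independent tf (suc n) (λ k → S (suc n) k - (shift (S n) k + diag n k * S n k))
      (λ m → difference (fromℕ R m)) k k≤1+n)
    where
    difference : ∀ x →
      ∑ (suc n) (λ k → (S (suc n) k - (shift (S n) k + diag n k * S n k)) * fall R x k) ≈ 0#
    difference x = begin
      ∑ (suc n) (λ k → (S (suc n) k - (shift (S n) k + diag n k * S n k)) * fall R x k)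
        ≈⟨ ∑-cong (suc n) (λ k → [y-z]x≈yx-zx (fall R x k) _ _) ⟩
      ∑ (suc n) (λ k → S (suc n) k * fall R x k - (shift (S n) k + diag n k * S n k) * fall R x k)
        ≈⟨ ∑-- (suc n) _ _ ⟩
      ∑ (suc n) (λ k → S (suc n) k * fall R x k)
        - ∑ (suc n) (λ k → (shift (S n) k + diag n k * S n k) * fall R x k)
        ≈⟨ +-cong (sym (S-expansion (suc n) x)) (-‿cong (next-row-expansion n x)) ⟩
      fallD R lam x (suc n) - fallD R lam x (suc n)
        ≈⟨ -‿inverseʳ _ ⟩
      0# ∎
  ... | no k≰1+n = beyond-support k (ℕ.≰⇒> k≰1+n)
    where
    beyond-support : ∀ k → suc n < k → S (suc n) k ≈ shift (S n) k + diag n k * S n k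
    beyond-support (suc k) (s≤s n<k) = begin
      S (suc n) (suc k)                     ≈⟨ S-vanish (suc n) (suc k) (s≤s n<k) ⟩
      0#                                    ≈⟨ +-identityʳ 0# ⟨
      0# + 0#                               ≈⟨ +-cong (S-vanish n k n<k) (zeroʳ _) ⟨
      S n k + diag n (suc k) * 0#           ≈⟨ +-congˡ (*-congˡ Sₙₖ₊₁≈0) ⟨
      S n k + diag n (suc k) * S n (suc k)  ∎
      where
      Sₙₖ₊₁≈0 : S n (suc k) ≈ 0#
      Sₙₖ₊₁≈0 = S-vanish n (suc k) (ℕ.m<n⇒m<1+n n<k)

module AAlgorithm {c ℓ} (R : CommutativeRing c ℓ) where
  open CommutativeRing R
  open import Algebra.Properties.Ring ring using (x[y-z]≈xy-xz)
  open import Algebra.Properties.CommutativeSemigroup *-commutativeSemigroup using (x∙yz≈y∙xz)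
  open SetoidReasoning setoid
  open IntegerCoefficientSolver R
  open SumProperties R

  -- bmat R lam b (suc n) is definitionally step (fromℕ R n * lam) (bmat R lam b n).
  step : Carrier → (ℕ → Carrier) → ℕ → Carrier
  step d f m = (fromℕ R (suc m) - d) * f m - fromℕ R (suc m) * f (suc m)

  step-cong : ∀ d {f g : ℕ → Carrier} → (∀ m → f m ≈ g m) →
    ∀ m → step d f m ≈ step d g m
  step-cong d f≈g m = +-cong (*-congˡ (f≈g m)) (-‿cong (*-congˡ (f≈g (suc m))))

  step-comm : ∀ d e f m → step d (step e f) m ≈ step e (step d f) m
  step-comm d e f m = solve 7
    (λ d e M M′ x y z →
      (M :- d) :* ((M :- e) :* x :- M :* y) :- M :* ((M′ :- e) :* y :- M′ :* z)
      := (M :- e) :* ((M :- d) :* x :- M :* y) :- M :* ((M′ :- d) :* y :- M′ :* z))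
    refl d e (fromℕ R (suc m)) (fromℕ R (suc (suc m))) (f m) (f (suc m)) (f (suc (suc m)))

  step-shift : ∀ d e f m → step d f m ≈ step e f m + (e - d) * f m
  step-shift d e f m = solve 5
    (λ d e M x y → (M :- d) :* x :- M :* y := ((M :- e) :* x :- M :* y) :+ (e :- d) :* x)
    refl d e (fromℕ R (suc m)) (f m) (f (suc m))

  step-∑ : ∀ n d (a : ℕ → Carrier) (g : ℕ → ℕ → Carrier) m →
    step d (λ m → ∑ n (λ k → a k * g k m)) m ≈ ∑ n (λ k → a k * step d (g k) m)
  step-∑ n d a g m = begin
    (M - d) * ∑ n (λ k → a k * g k m) - M * ∑ n (λ k → a k * g k (suc m))
      ≈⟨ +-cong (∑-*ˡ n _ _) (-‿cong (∑-*ˡ n _ _)) ⟩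
    ∑ n (λ k → (M - d) * (a k * g k m)) - ∑ n (λ k → M * (a k * g k (suc m)))
      ≈⟨ ∑-- n _ _ ⟨
    ∑ n (λ k → (M - d) * (a k * g k m) - M * (a k * g k (suc m)))
      ≈⟨ ∑-cong n (λ k → +-cong (x∙yz≈y∙xz _ (a k) _) (-‿cong (x∙yz≈y∙xz _ (a k) _))) ⟩
    ∑ n (λ k → a k * ((M - d) * g k m) - a k * (M * g k (suc m)))
      ≈⟨ ∑-cong n (λ k → x[y-z]≈xy-xz (a k) _ _) ⟨
    ∑ n (λ k → a k * step d (g k) m) ∎
    where
    M : Carrier
    M = fromℕ R (suc m)

  bmat-step-comm : ∀ lam d b n m → bmat R lam (step d b) n m ≈ step d (bmat R lam b n) m
  bmat-step-comm lam d b zero    m = refl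
  bmat-step-comm lam d b (suc n) m =
    trans (step-cong _ (bmat-step-comm lam d b n) m) (step-comm _ d (bmat R lam b n) m)

  -- At index k - 1 the step with parameter k kills the b (k - 1) term.
  Δ-step : ∀ k b → Δ (step (fromℕ R k * 1#) b) k ≈ - (fromℕ R (suc k) * Δ b (suc k))
  Δ-step zero b = solve 2
    (λ x y →
      ((con (+ 1) :+ con (+ 0)) :- con (+ 0) :* con (+ 1)) :* x :- (con (+ 1) :+ con (+ 0)) :* y
        :- con (+ 0)
      := :- ((con (+ 1) :+ con (+ 0)) :* (y :- x)))
    refl (b 0) (b 1)
  Δ-step (suc k) b = solve 4
    (λ K x y z →
      ((con (+ 1) :+ (con (+ 1) :+ K)) :- (con (+ 1) :+ K) :* con (+ 1)) :* y
        :- (con (+ 1) :+ (con (+ 1) :+ K)) :* z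
      :- (((con (+ 1) :+ K) :- (con (+ 1) :+ K) :* con (+ 1)) :* x :- (con (+ 1) :+ K) :* y)
      := :- ((con (+ 1) :+ (con (+ 1) :+ K)) :* (z :- y)))
    refl (fromℕ R k) (b k) (b (suc k)) (b (suc (suc k)))

  bmat-1#-at-0 : ∀ k b → bmat R 1# b k 0 ≈ sgn R k * fact R k * Δ b k
  bmat-1#-at-0 zero b = solve 1 (λ x → x := con (+ 1) :* con (+ 1) :* (x :- con (+ 0))) refl (b 0)
  bmat-1#-at-0 (suc k) b = begin
    step (fromℕ R k * 1#) (bmat R 1# b k) 0
      ≈⟨ bmat-step-comm 1# _ b k 0 ⟨
    bmat R 1# (step (fromℕ R k * 1#) b) k 0
      ≈⟨ bmat-1#-at-0 k _ ⟩
    sgn R k * fact R k * Δ (step (fromℕ R k * 1#) b) k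
      ≈⟨ *-congˡ (Δ-step k b) ⟩
    sgn R k * fact R k * - (fromℕ R (suc k) * Δ b (suc k))
      ≈⟨ solve 4 (λ s f K x → s :* f :* :- (K :* x) := :- s :* (K :* f) :* x) refl
           (sgn R k) (fact R k) (fromℕ R (suc k)) (Δ b (suc k)) ⟩
    sgn R (suc k) * fact R (suc k) * Δ b (suc k) ∎

module DegenerateAAlgorithm
  {c ℓ} (R : CommutativeRing c ℓ) (tf : TorsionFree R)
  (lam : CommutativeRing.Carrier R) (S : ℕ → ℕ → CommutativeRing.Carrier R)
  (isS : IsDegStirling2 R lam S) where
  open CommutativeRing R
  open SetoidReasoning setoid
  open IntegerCoefficientSolver R
  open SumProperties R
  open DegenerateStirlingRecurrence R tf lam S isS
  open AAlgorithm R

  bmat-expansion : ∀ b n m → bmat R lam b n m ≈ ∑ n (λ k → S n k * bmat R 1# b k m)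
  bmat-expansion b zero    m = sym (trans (*-congʳ S₀₀≈1) (*-identityˡ (b m)))
  bmat-expansion b (suc n) m = begin
    step (fromℕ R n * lam) (bmat R lam b n) m
      ≈⟨ step-cong _ (bmat-expansion b n) m ⟩
    step (fromℕ R n * lam) (λ m → ∑ n (λ k → S n k * G k m)) m
      ≈⟨ step-∑ n _ (S n) G m ⟩
    ∑ n (λ k → S n k * step (fromℕ R n * lam) (G k) m)
      ≈⟨ ∑-cong n (λ k → *-congˡ (G-step k)) ⟩
    ∑ n (λ k → S n k * (G (suc k) m + diag n k * G k m))
      ≈⟨ ∑-shift-adjoint n (S n) (diag n) (λ k → G k m) (S-vanish n (suc n) (ℕ.n<1+n n)) ⟨
    ∑ (suc n) (λ k → (shift (S n) k + diag n k * S n k) * G k m)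
      ≈⟨ ∑-cong (suc n) (λ k → *-congʳ (S-recurrence n k)) ⟨
    ∑ (suc n) (λ k → S (suc n) k * G k m) ∎
    where
    G : ℕ → ℕ → Carrier
    G = bmat R 1# b
    G-step : ∀ k → step (fromℕ R n * lam) (G k) m ≈ G (suc k) m + diag n k * G k m
    G-step k = trans (step-shift _ (fromℕ R k * 1#) (G k) m)
      (+-congˡ (*-congʳ (+-congʳ (*-identityʳ (fromℕ R k)))))

  Abel-coefficient : ∀ n k →
    S n k * (sgn R k * fact R k) - S n (suc k) * (sgn R (suc k) * fact R (suc k))
      ≈ sgn R k * fact R k * (S (suc n) (suc k) + fromℕ R n * lam * S n (suc k))
  Abel-coefficient n k = trans
    (solve 6 (λ s f a b K c →
        a :* (s :* f) :- b :* (:- s :* ((con (+ 1) :+ K) :* f))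
        := s :* f :* ((a :+ ((con (+ 1) :+ K) :- c) :* b) :+ c :* b))
      refl (sgn R k) (fact R k) (S n k) (S n (suc k)) (fromℕ R k) (fromℕ R n * lam))
    (*-congˡ (+-congʳ (sym (S-recurrence n (suc k)))))

theorem3p1 : ∀ {c ℓ : Level} (R : CommutativeRing c ℓ) →
    let open CommutativeRing R in
    TorsionFree R →
    (lam : Carrier) → ¬ (lam ≈ 0#) →
    (b : ℕ → Carrier) →
    (S : ℕ → ℕ → Carrier) → IsDegStirling2 R lam S →
    ∀ (n : ℕ) →
      bmat R lam b n 0 ≈
        sumTo R n (λ k → (sgn R k * fact R k)
          * (S (suc n) (suc k) + (fromℕ R n * lam) * S n (suc k))
          * bmat R lam b 0 k)
theorem3p1 R tf lam _ b S isS n = begin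
  bmat R lam b n 0
    ≈⟨ bmat-expansion b n 0 ⟩
  ∑ n (λ k → S n k * bmat R 1# b k 0)
    ≈⟨ ∑-cong n (λ k → trans (*-congˡ (bmat-1#-at-0 k b)) (sym (*-assoc _ _ _))) ⟩
  ∑ n (λ k → S n k * s k * Δ b k)
    ≈⟨ ∑-by-parts n (λ k → S n k * s k) b top-vanishes ⟩
  ∑ n (λ k → (S n k * s k - S n (suc k) * s (suc k)) * b k)
    ≈⟨ ∑-cong n (λ k → *-congʳ (Abel-coefficient n k)) ⟩
  ∑ n (λ k → s k * (S (suc n) (suc k) + fromℕ R n * lam * S n (suc k)) * b k) ∎
  where
  open CommutativeRing R
  open SetoidReasoning setoid
  open SumProperties R
  open DegenerateStirlingRecurrence R tf lam S isS
  open AAlgorithm R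
  open DegenerateAAlgorithm R tf lam S isS
  s : ℕ → Carrier
  s k = sgn R k * fact R k
  top-vanishes : S n (suc n) * s (suc n) ≈ 0#
  top-vanishes = trans (*-congʳ (S-vanish n (suc n) (ℕ.n<1+n n))) (zeroˡ _)
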